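{- Let $G$ be a maximal outerplanar graph of diameter $D$ and let $M$ be a maximum parallel matching in $G$. Then $|M|=D-1$.
   Context: An outerplanar graph is maximal if it is $2$-connected and all inner faces of its outerplanar embedding are triangles; such a graph has a unique outerplanar embedding, viewed as a cyclic ordering of its vertices around the outer boundary. A matching $u_1v_1,\ldots,u_kv_k$ of $G$ is a parallel matching if $u_1,\ldots,u_k,v_k,\ldots,v_1$ appear in this cyclic order with respect to the embedding, and moreover some vertex lies (in the cyclic order) between $u_1$ and $v_1$ on the side not containing the other matched vertices, and likewise some vertex lies between $u_k$ and $v_k$ on the side not containing the other matched vertices. -}

module Defs where

open import Data.Nat using (ℕ; zero; suc; _+_; _∸_; _≤_; _<_; _≤ᵇ_)
open import Data.Fin using (Fin; toℕ)
open import Data.Bool using (if_then_else_)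
open import Data.Product using (_×_; ∃; ∃-syntax; Σ-syntax)
open import Data.Sum using (_⊎_)
open import Relation.Nullary using (¬_)
open import Relation.Binary.PropositionalEquality using (_≡_; _≢_)

Graph : ℕ → Set₁
Graph n = Fin n → Fin n → Set

-- Convention: the vertices are labelled 0,1,…,n-1 in the cyclic order of the
-- (unique) outerplanar embedding; edges are chords of the circle.

_≺_ : ∀ {n} → Fin n → Fin n → Set
a ≺ b = toℕ a < toℕ b

Ord4 : ∀ {n} → Fin n → Fin n → Fin n → Fin n → Set
Ord4 p q r s = (p ≺ q) × (q ≺ r) × (r ≺ s)

-- The chords {x,y} and {z,w} cross (their endpoints interleave on the circle).
Cross : ∀ {n} → Fin n → Fin n → Fin n → Fin n → Set
Cross x y z w =
  Ord4 x z y w ⊎ Ord4 x w y z ⊎ Ord4 y z x w ⊎ Ord4 y w x z ⊎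
  Ord4 z x w y ⊎ Ord4 z y w x ⊎ Ord4 w x z y ⊎ Ord4 w y z x

-- Maximal outerplanar graph whose outerplanar embedding lists the vertices
-- in the order 0,1,…,n-1: a simple graph on n ≥ 3 vertices drawn with
-- non-crossing chords, in which every chord crossing no edge is an edge
-- (i.e. all boundary-cycle edges are present, so G is 2-connected with
-- outer face the Hamiltonian cycle, and all inner faces are triangles).
record MaximalOuterplanar (n : ℕ) (E : Graph n) : Set where
  field
    three≤n     : 3 ≤ n
    irreflexive : ∀ a → ¬ E a a
    symmetric   : ∀ a b → E a b → E b a
    nonCrossing : ∀ a b c d → E a b → E c d → ¬ Cross a b c d
    saturated   : ∀ a b → a ≢ b → (∀ c d → E c d → ¬ Cross a b c d) → E a b

data Walk {n : ℕ} (E : Graph n) : ℕ → Fin n → Fin n → Set where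
  here : ∀ x → Walk E zero x x
  step : ∀ {k x y z} → E x y → Walk E k y z → Walk E (suc k) x z

HasDiameter : ∀ {n} → Graph n → ℕ → Set
HasDiameter {n} E D =
  (∀ x y → ∃[ m ] (m ≤ D × Walk E m x y)) ×
  (∃[ x ] ∃[ y ] (∀ m → Walk E m x y → D ≤ m))

-- forward cyclic distance from a to b (number of steps a → a+1 → … → b mod n)
cdist : ∀ {n} → Fin n → Fin n → ℕ
cdist {n} a b = if toℕ a ≤ᵇ toℕ b then toℕ b ∸ toℕ a else (n + toℕ b) ∸ toℕ a

-- A parallel matching u₀v₀,…,u_{k-1}v_{k-1} (indices from 0):
-- each uᵢvᵢ is an edge; u₀,…,u_{k-1},v_{k-1},…,v₀ appear (distinct) in this
-- cyclic order, i.e. for some starting point s their forward distances from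
-- s are strictly increasing along that sequence; there is a vertex strictly
-- between v₀ and u₀ (going forward from v₀), and a vertex strictly between
-- u_{k-1} and v_{k-1} (going forward from u_{k-1}).
record ParallelMatching {n : ℕ} (E : Graph n) (k : ℕ)
       (u v : Fin k → Fin n) : Set where
  field
    edges    : ∀ i → E (u i) (v i)
    start    : Fin n
    uOrder   : ∀ i j → i ≺ j → cdist start (u i) < cdist start (u j)
    uvOrder  : ∀ i j → cdist start (u i) < cdist start (v j)
    vOrder   : ∀ i j → i ≺ j → cdist start (v j) < cdist start (v i)
    gapFirst : ∀ i → toℕ i ≡ 0 → 2 ≤ cdist (v i) (u i)
    gapLast  : ∀ i → suc (toℕ i) ≡ k → 2 ≤ cdist (u i) (v i)

HasParallelMatching : ∀ {n} → Graph n → ℕ → Set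
HasParallelMatching {n} E k =
  Σ[ u ∈ (Fin k → Fin n) ] Σ[ v ∈ (Fin k → Fin n) ] ParallelMatching E k u v

record MaximumParallelMatching {n : ℕ} (E : Graph n) (k : ℕ)
       (u v : Fin k → Fin n) : Set where
  field
    isParallel : ParallelMatching E k u v
    maximum    : ∀ k' → HasParallelMatching E k' → k' ≤ k

{-# OPTIONS --safe #-}
-- Positions on the outer cycle are measured from an origin by forward distance; two chords
-- cross iff their endpoints interleave, whatever the origin.
--
-- k ≤ D - 1: the chords of a parallel matching are nested, so a vertex just outside the first
-- chord and a vertex just inside the last one are separated by all k chords. A walk from
-- outside a chord to its inside passes through an endpoint of it (chords do not cross), so
-- every walk between the two vertices has length at least k + 1.
--
-- D - 1 ≤ k: take x, y at distance D and measure distances from x. For 1 ≤ i < D, among the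
-- chords separating x from y with both ends at distance ≤ i take the one closest to y. The apex
-- of its triangle towards y is at distance > i, as otherwise it would span a chord closer to y,
-- so both ends are at distance exactly i. Chords of different levels are nested, hence these
-- D - 1 chords form a parallel matching.

module Submission where

open import Defs
open import Data.Bool using (true; false; T)
open import Data.Empty using (⊥; ⊥-elim)
open import Data.Fin using (Fin; zero; suc; toℕ; fromℕ; fromℕ<; inject₁)
open import Data.Fin.Induction using (<-weakInduction)
open import Data.Fin.Properties using (toℕ<n; toℕ-injective; toℕ-fromℕ<; toℕ-fromℕ; toℕ-inject₁; any?; sequence)
  renaming (_≟_ to _≟ᶠ_)
open import Data.List using (List; filter; allFin; cartesianProduct)
open import Data.List.Extrema.Nat using (argmax; argmax-all; f[xs]≤f[argmax])
open import Data.List.Membership.Propositional using (_∈_)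
open import Data.List.Membership.Propositional.Properties using (∈-filter⁺; ∈-allFin; ∈-cartesianProduct⁺)
open import Data.List.Relation.Unary.All using (lookup)
open import Data.List.Relation.Unary.All.Properties using (all-filter)
open import Data.Nat
open import Data.Nat.Properties
open import Data.Product using (_×_; _,_; ∃-syntax; proj₁; proj₂)
open import Data.Sum using (_⊎_; inj₁; inj₂; [_,_]′)
open import Data.Unit using (⊤; tt)
open import Effect.Monad using (RawMonad)
open import Function using (_∘_)
open import Relation.Binary using (tri<; tri≈; tri>)
open import Relation.Binary.Definitions using () renaming (Decidable to Decidable₂)
open import Relation.Binary.PropositionalEquality
open import Relation.Nullary using (¬_; Dec; yes; no; contradiction; _×-dec_)
open import Relation.Nullary.Decidable using (¬¬-excluded-middle; decidable-stable)
open import Relation.Nullary.Negation using (¬¬-Monad; ¬¬-map)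
open import Relation.Unary using (Decidable)

module _ {X : Set} (f : X → ℕ) where

  Chain : X → X → X → X → Set
  Chain p q r s = f p < f q × f q < f r × f r < f s

  Cyclic : X → X → X → X → Set
  Cyclic p q r s = Chain p q r s ⊎ Chain q r s p ⊎ Chain r s p q ⊎ Chain s p q r

  Interleaved : X → X → X → X → Set
  Interleaved a b c d = Cyclic a c b d ⊎ Cyclic a d b c

  Inside : X → X → X → Set
  Inside a b c = f a < f c × f c < f b

  Outside : X → X → X → Set
  Outside a b d = f d < f a ⊎ f b < f d

  cyclic-rotate : ∀ {p q r s} → Cyclic p q r s → Cyclic q r s p
  cyclic-rotate (inj₁ c)               = inj₂ (inj₂ (inj₂ c))
  cyclic-rotate (inj₂ (inj₁ c))        = inj₁ c
  cyclic-rotate (inj₂ (inj₂ (inj₁ c))) = inj₂ (inj₁ c)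
  cyclic-rotate (inj₂ (inj₂ (inj₂ c))) = inj₂ (inj₂ (inj₁ c))

  separated⇒interleaved : ∀ {a b c d} → Inside a b c → Outside a b d → Interleaved a b c d
  separated⇒interleaved (ac , cb) (inj₁ da) = inj₁ (inj₂ (inj₂ (inj₂ (da , ac , cb))))
  separated⇒interleaved (ac , cb) (inj₂ bd) = inj₁ (inj₁ (ac , cb , bd))

  interleaved⇒separated : ∀ {a b c d} → f a < f b → Interleaved a b c d →
                          (Inside a b c × Outside a b d) ⊎ (Inside a b d × Outside a b c)
  interleaved⇒separated ab (inj₁ (inj₁ (ac , cb , bd)))               = inj₁ ((ac , cb) , inj₂ bd)
  interleaved⇒separated ab (inj₁ (inj₂ (inj₁ (_ , bd , da))))         = ⊥-elim (<-asym ab (<-trans bd da))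
  interleaved⇒separated ab (inj₁ (inj₂ (inj₂ (inj₁ (bd , da , _)))))  = ⊥-elim (<-asym ab (<-trans bd da))
  interleaved⇒separated ab (inj₁ (inj₂ (inj₂ (inj₂ (da , ac , cb))))) = inj₁ ((ac , cb) , inj₁ da)
  interleaved⇒separated ab (inj₂ (inj₁ (ad , db , bc)))               = inj₂ ((ad , db) , inj₂ bc)
  interleaved⇒separated ab (inj₂ (inj₂ (inj₁ (_ , bc , ca))))         = ⊥-elim (<-asym ab (<-trans bc ca))
  interleaved⇒separated ab (inj₂ (inj₂ (inj₂ (inj₁ (bc , ca , _)))))  = ⊥-elim (<-asym ab (<-trans bc ca))
  interleaved⇒separated ab (inj₂ (inj₂ (inj₂ (inj₂ (ca , ad , db))))) = inj₂ ((ad , db) , inj₁ ca)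

-- g measures positions on the circle of f from another origin.
Rotation : {X : Set} → (X → ℕ) → (X → ℕ) → Set
Rotation f g = ∀ {p q r s} → Chain g p q r s → Cyclic f p q r s

module _ {X : Set} {f g : X → ℕ} (rotation : Rotation f g) where

  rotation-cyclic : ∀ {p q r s} → Cyclic g p q r s → Cyclic f p q r s
  rotation-cyclic (inj₁ c)               = rotation c
  rotation-cyclic (inj₂ (inj₁ c))        = cyclic-rotate f (cyclic-rotate f (cyclic-rotate f (rotation c)))
  rotation-cyclic (inj₂ (inj₂ (inj₁ c))) = cyclic-rotate f (cyclic-rotate f (rotation c))
  rotation-cyclic (inj₂ (inj₂ (inj₂ c))) = cyclic-rotate f (rotation c)

  rotation-interleaved : ∀ {a b c d} → Interleaved g a b c d → Interleaved f a b c d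
  rotation-interleaved (inj₁ i) = inj₁ (rotation-cyclic i)
  rotation-interleaved (inj₂ i) = inj₂ (rotation-cyclic i)

-- Cutting an order into two blocks and swapping them is a rotation.
module _ {X : Set} (f g : X → ℕ) {P : X → Set} (P? : Decidable P)
         (agree-in  : ∀ {w z} → P w → P z → g w < g z → f w < f z)
         (agree-out : ∀ {w z} → ¬ P w → ¬ P z → g w < g z → f w < f z)
         (block-g   : ∀ {w z} → P w → ¬ P z → g w < g z)
         (block-f   : ∀ {w z} → P w → ¬ P z → f z < f w) where

  block-rotation : Rotation f g
  block-rotation {p} {q} {r} {s} (pq , qr , rs) with P? p | P? q | P? r | P? s
  ... | yes Pp | yes Pq | yes Pr | yes Ps = inj₁ (agree-in Pp Pq pq , agree-in Pq Pr qr , agree-in Pr Ps rs)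
  ... | yes Pp | yes Pq | yes Pr | no ¬Ps = inj₂ (inj₂ (inj₂ (block-f Pp ¬Ps , agree-in Pp Pq pq , agree-in Pq Pr qr)))
  ... | yes Pp | yes Pq | no ¬Pr | no ¬Ps = inj₂ (inj₂ (inj₁ (agree-out ¬Pr ¬Ps rs , block-f Pp ¬Ps , agree-in Pp Pq pq)))
  ... | yes Pp | no ¬Pq | no ¬Pr | no ¬Ps = inj₂ (inj₁ (agree-out ¬Pq ¬Pr qr , agree-out ¬Pr ¬Ps rs , block-f Pp ¬Ps))
  ... | no ¬Pp | no ¬Pq | no ¬Pr | no ¬Ps = inj₁ (agree-out ¬Pp ¬Pq pq , agree-out ¬Pq ¬Pr qr , agree-out ¬Pr ¬Ps rs)
  ... | no ¬Pp | yes Pq | _      | _      = ⊥-elim (<-asym pq (block-g Pq ¬Pp))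
  ... | _      | no ¬Pq | yes Pr | _      = ⊥-elim (<-asym qr (block-g Pr ¬Pq))
  ... | _      | _      | no ¬Pr | yes Ps = ⊥-elim (<-asym rs (block-g Ps ¬Pr))

cross⇒interleaved : ∀ {n} {a b c d : Fin n} → Cross a b c d → Interleaved toℕ a b c d
cross⇒interleaved (inj₁ o)                                           = inj₁ (inj₁ o)
cross⇒interleaved (inj₂ (inj₁ o))                                    = inj₂ (inj₁ o)
cross⇒interleaved (inj₂ (inj₂ (inj₁ o)))                             = inj₂ (inj₂ (inj₂ (inj₁ o)))
cross⇒interleaved (inj₂ (inj₂ (inj₂ (inj₁ o))))                      = inj₁ (inj₂ (inj₂ (inj₁ o)))
cross⇒interleaved (inj₂ (inj₂ (inj₂ (inj₂ (inj₁ o)))))               = inj₂ (inj₂ (inj₂ (inj₂ o)))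
cross⇒interleaved (inj₂ (inj₂ (inj₂ (inj₂ (inj₂ (inj₁ o))))))        = inj₁ (inj₂ (inj₁ o))
cross⇒interleaved (inj₂ (inj₂ (inj₂ (inj₂ (inj₂ (inj₂ (inj₁ o))))))) = inj₁ (inj₂ (inj₂ (inj₂ o)))
cross⇒interleaved (inj₂ (inj₂ (inj₂ (inj₂ (inj₂ (inj₂ (inj₂ o))))))) = inj₂ (inj₂ (inj₁ o))

interleaved⇒cross : ∀ {n} {a b c d : Fin n} → Interleaved toℕ a b c d → Cross a b c d
interleaved⇒cross (inj₁ (inj₁ o))               = inj₁ o
interleaved⇒cross (inj₁ (inj₂ (inj₁ o)))        = inj₂ (inj₂ (inj₂ (inj₂ (inj₂ (inj₁ o)))))
interleaved⇒cross (inj₁ (inj₂ (inj₂ (inj₁ o)))) = inj₂ (inj₂ (inj₂ (inj₁ o)))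
interleaved⇒cross (inj₁ (inj₂ (inj₂ (inj₂ o)))) = inj₂ (inj₂ (inj₂ (inj₂ (inj₂ (inj₂ (inj₁ o))))))
interleaved⇒cross (inj₂ (inj₁ o))               = inj₂ (inj₁ o)
interleaved⇒cross (inj₂ (inj₂ (inj₁ o)))        = inj₂ (inj₂ (inj₂ (inj₂ (inj₂ (inj₂ (inj₂ o))))))
interleaved⇒cross (inj₂ (inj₂ (inj₂ (inj₁ o)))) = inj₂ (inj₂ (inj₁ o))
interleaved⇒cross (inj₂ (inj₂ (inj₂ (inj₂ o)))) = inj₂ (inj₂ (inj₂ (inj₂ (inj₁ o))))

module _ {n : ℕ} where

  cdist-up : (a b : Fin n) → toℕ a ≤ toℕ b → toℕ a + cdist a b ≡ toℕ b
  cdist-up a b a≤b with toℕ a ≤ᵇ toℕ b | ≤⇒≤ᵇ a≤b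
  ... | true | _ = m+[n∸m]≡n a≤b

  cdist-down : (a b : Fin n) → toℕ b < toℕ a → toℕ a + cdist a b ≡ n + toℕ b
  cdist-down a b b<a with toℕ a ≤ᵇ toℕ b in a≤ᵇb
  ... | true  = contradiction (≤ᵇ⇒≤ _ _ (subst T (sym a≤ᵇb) tt)) (<⇒≱ b<a)
  ... | false = m+[n∸m]≡n (≤-trans (<⇒≤ (toℕ<n a)) (m≤m+n n (toℕ b)))

  private
    lift-< : ∀ k {a b c d} → k + a ≡ c → k + b ≡ d → a < b → c < d
    lift-< k e₁ e₂ a<b = subst₂ _<_ e₁ e₂ (+-monoʳ-< k a<b)

    drop-< : ∀ k {a b c d} → k + a ≡ c → k + b ≡ d → c < d → a < b
    drop-< k e₁ e₂ c<d = +-cancelˡ-< k _ _ (subst₂ _<_ (sym e₁) (sym e₂) c<d)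

    offset-sum : ∀ k {p c q x y} → k + p ≡ x → x + c ≡ y → k + q ≡ y → p + c ≡ q
    offset-sum k {p} {c} {q} {x} {y} e₁ e₂ e₃ = +-cancelˡ-≡ k _ _ (begin
      k + (p + c)  ≡⟨ +-assoc k p c ⟨
      k + p + c    ≡⟨ cong (_+ c) e₁ ⟩
      x + c        ≡⟨ e₂ ⟩
      y            ≡⟨ e₃ ⟨
      k + q        ∎)
      where open ≡-Reasoning

    unwrapped<wrapped : ∀ k {c c′} (a b : Fin n) → k + c ≡ toℕ a → k + c′ ≡ n + toℕ b → c < c′
    unwrapped<wrapped k a b e₁ e₂ = drop-< k e₁ e₂ (<-≤-trans (toℕ<n a) (m≤m+n n (toℕ b)))

  cdist<n : (a b : Fin n) → cdist a b < n
  cdist<n a b with ≤-<-connex (toℕ a) (toℕ b)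
  ... | inj₁ a≤b = ≤-<-trans (m≤n+m _ (toℕ a)) (subst (_< n) (sym (cdist-up a b a≤b)) (toℕ<n b))
  ... | inj₂ b<a = drop-< (toℕ a) (cdist-down a b b<a) (+-comm (toℕ a) n) (+-monoʳ-< n b<a)

  cdist-self : (a : Fin n) → cdist a a ≡ 0
  cdist-self a = +-cancelˡ-≡ (toℕ a) _ _ (trans (cdist-up a a ≤-refl) (sym (+-identityʳ (toℕ a))))

  cdist-injective : (s : Fin n) {a b : Fin n} → cdist s a ≡ cdist s b → a ≡ b
  cdist-injective s {a} {b} eq with ≤-<-connex (toℕ s) (toℕ a) | ≤-<-connex (toℕ s) (toℕ b)
  ... | inj₁ s≤a | inj₁ s≤b = toℕ-injective (begin
    toℕ a              ≡⟨ cdist-up s a s≤a ⟨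
    toℕ s + cdist s a  ≡⟨ cong (toℕ s +_) eq ⟩
    toℕ s + cdist s b  ≡⟨ cdist-up s b s≤b ⟩
    toℕ b              ∎)
    where open ≡-Reasoning
  ... | inj₂ a<s | inj₂ b<s = toℕ-injective (+-cancelˡ-≡ n _ _ (begin
    n + toℕ a          ≡⟨ cdist-down s a a<s ⟨
    toℕ s + cdist s a  ≡⟨ cong (toℕ s +_) eq ⟩
    toℕ s + cdist s b  ≡⟨ cdist-down s b b<s ⟩
    n + toℕ b          ∎))
    where open ≡-Reasoning
  ... | inj₁ s≤a | inj₂ b<s =
    ⊥-elim (<-irrefl eq (unwrapped<wrapped (toℕ s) a b (cdist-up s a s≤a) (cdist-down s b b<s)))
  ... | inj₂ a<s | inj₁ s≤b =
    ⊥-elim (<-irrefl (sym eq) (unwrapped<wrapped (toℕ s) b a (cdist-up s b s≤b) (cdist-down s a a<s)))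

  cdist-surjective : (s : Fin n) {r : ℕ} → r < n → ∃[ w ] cdist s w ≡ r
  cdist-surjective s {r} r<n with toℕ s + r <? n
  ... | yes s+r<n = w , +-cancelˡ-≡ (toℕ s) _ _ (trans (cdist-up s w s≤w) (toℕ-fromℕ< s+r<n))
    where
    w = fromℕ< s+r<n
    s≤w : toℕ s ≤ toℕ w
    s≤w = subst (toℕ s ≤_) (sym (toℕ-fromℕ< s+r<n)) (m≤m+n (toℕ s) r)
  ... | no s+r≮n = w , +-cancelˡ-≡ (toℕ s) _ _ (begin-equality
      toℕ s + cdist s w    ≡⟨ cdist-down s w w<s ⟩
      n + toℕ w            ≡⟨ cong (n +_) (toℕ-fromℕ< w<n) ⟩
      n + (toℕ s + r ∸ n)  ≡⟨ m+[n∸m]≡n n≤s+r ⟩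
      toℕ s + r            ∎)
    where
    open ≤-Reasoning
    n≤s+r : n ≤ toℕ s + r
    n≤s+r = ≮⇒≥ s+r≮n
    w<s′ : toℕ s + r ∸ n < toℕ s
    w<s′ = +-cancelˡ-< n _ _ (begin-strict
      n + (toℕ s + r ∸ n)  ≡⟨ m+[n∸m]≡n n≤s+r ⟩
      toℕ s + r            <⟨ +-monoʳ-< (toℕ s) r<n ⟩
      toℕ s + n            ≡⟨ +-comm (toℕ s) n ⟩
      n + toℕ s            ∎)
    w<n : toℕ s + r ∸ n < n
    w<n = <-trans w<s′ (toℕ<n s)
    w = fromℕ< w<n
    w<s : toℕ w < toℕ s
    w<s = subst (_< toℕ s) (sym (toℕ-fromℕ< w<n)) w<s′

  cdist-trans : (s a b : Fin n) → cdist s a ≤ cdist s b → cdist s a + cdist a b ≡ cdist s b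
  cdist-trans s a b sa≤sb
    with ≤-<-connex (toℕ s) (toℕ a) | ≤-<-connex (toℕ s) (toℕ b) | ≤-<-connex (toℕ a) (toℕ b)
  ... | inj₁ s≤a | inj₁ s≤b | inj₁ a≤b =
    offset-sum (toℕ s) (cdist-up s a s≤a) (cdist-up a b a≤b) (cdist-up s b s≤b)
  ... | inj₁ s≤a | inj₂ b<s | inj₂ b<a =
    offset-sum (toℕ s) (cdist-up s a s≤a) (cdist-down a b b<a) (cdist-down s b b<s)
  ... | inj₂ a<s | inj₂ b<s | inj₁ a≤b =
    offset-sum (toℕ s) (cdist-down s a a<s) (trans (+-assoc n _ _) (cong (n +_) (cdist-up a b a≤b))) (cdist-down s b b<s)
  ... | inj₁ s≤a | inj₁ s≤b | inj₂ b<a =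
    ⊥-elim (<⇒≱ (drop-< (toℕ s) (cdist-up s b s≤b) (cdist-up s a s≤a) b<a) sa≤sb)
  ... | inj₁ s≤a | inj₂ b<s | inj₁ a≤b = ⊥-elim (<⇒≱ b<s (≤-trans s≤a a≤b))
  ... | inj₂ a<s | inj₁ s≤b | _        =
    ⊥-elim (<⇒≱ (unwrapped<wrapped (toℕ s) b a (cdist-up s b s≤b) (cdist-down s a a<s)) sa≤sb)
  ... | inj₂ a<s | inj₂ b<s | inj₂ b<a =
    ⊥-elim (<⇒≱ (drop-< (toℕ s) (cdist-down s b b<s) (cdist-down s a a<s) (+-monoʳ-< n b<a)) sa≤sb)

  cdist-cycle : {a b : Fin n} → a ≢ b → cdist a b + cdist b a ≡ n
  cdist-cycle {a} {b} a≢b with ≤-<-connex (toℕ a) (toℕ b)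
  ... | inj₁ a≤b = offset-sum (toℕ a) (cdist-up a b a≤b) (cdist-down b a a<b) (+-comm (toℕ a) n)
    where a<b = ≤∧≢⇒< a≤b (a≢b ∘ toℕ-injective)
  ... | inj₂ b<a = trans (+-comm (cdist a b) _)
                         (offset-sum (toℕ b) (cdist-up b a (<⇒≤ b<a)) (cdist-down a b b<a) (+-comm (toℕ b) n))

  cdist-wrap : (s a b : Fin n) → cdist s b < cdist s a → cdist s a + cdist a b ≡ n + cdist s b
  cdist-wrap s a b sb<sa = begin
    cdist s a + cdist a b                ≡⟨ cong (_+ cdist a b) (cdist-trans s b a (<⇒≤ sb<sa)) ⟨
    cdist s b + cdist b a + cdist a b    ≡⟨ +-assoc (cdist s b) _ _ ⟩
    cdist s b + (cdist b a + cdist a b)  ≡⟨ cong (cdist s b +_) (cdist-cycle b≢a) ⟩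
    cdist s b + n                        ≡⟨ +-comm (cdist s b) n ⟩
    n + cdist s b                        ∎
    where
    open ≡-Reasoning
    b≢a : b ≢ a
    b≢a b≡a = <-irrefl (cong (cdist s) b≡a) sb<sa

  rotation-toℕ-cdist : (s : Fin n) → Rotation toℕ (cdist s)
  rotation-toℕ-cdist s = block-rotation toℕ (cdist s) (λ w → toℕ s ≤? toℕ w)
    (λ {w} {z} s≤w s≤z → lift-< (toℕ s) (cdist-up s w s≤w) (cdist-up s z s≤z))
    (λ {w} {z} s≰w s≰z →
      +-cancelˡ-< n _ _ ∘ lift-< (toℕ s) (cdist-down s w (≰⇒> s≰w)) (cdist-down s z (≰⇒> s≰z)))
    (λ {w} {z} s≤w s≰z → unwrapped<wrapped (toℕ s) w z (cdist-up s w s≤w) (cdist-down s z (≰⇒> s≰z)))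
    (λ s≤w s≰z → <-≤-trans (≰⇒> s≰z) s≤w)

  rotation-cdist-toℕ : (s : Fin n) → Rotation (cdist s) toℕ
  rotation-cdist-toℕ s = block-rotation (cdist s) toℕ (λ w → toℕ w <? toℕ s)
    (λ {w} {z} w<s z<s → drop-< (toℕ s) (cdist-down s w w<s) (cdist-down s z z<s) ∘ +-monoʳ-< n)
    (λ {w} {z} w≮s z≮s → drop-< (toℕ s) (cdist-up s w (≮⇒≥ w≮s)) (cdist-up s z (≮⇒≥ z≮s)))
    (λ w<s z≮s → <-≤-trans w<s (≮⇒≥ z≮s))
    (λ {w} {z} w<s z≮s → unwrapped<wrapped (toℕ s) z w (cdist-up s z (≮⇒≥ z≮s)) (cdist-down s w w<s))

  module _ (s : Fin n) {a b : Fin n} (a<b : cdist s a < cdist s b) where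

    private
      a+1<b : 2 ≤ cdist a b → suc (cdist s a) < cdist s b
      a+1<b gap = begin
        suc (suc (cdist s a))  ≡⟨ +-comm 2 (cdist s a) ⟩
        cdist s a + 2          ≤⟨ +-monoʳ-≤ (cdist s a) gap ⟩
        cdist s a + cdist a b  ≡⟨ cdist-trans s a b (<⇒≤ a<b) ⟩
        cdist s b              ∎
        where open ≤-Reasoning

    inside⇒gap : ∀ {w} → Inside (cdist s) a b w → 2 ≤ cdist a b
    inside⇒gap (a<w , w<b) = +-cancelˡ-≤ (cdist s a) 2 _ (begin
      cdist s a + 2          ≡⟨ +-comm (cdist s a) 2 ⟩
      suc (suc (cdist s a))  ≤⟨ <-≤-trans (s≤s a<w) w<b ⟩
      cdist s b              ≡⟨ cdist-trans s a b (<⇒≤ a<b) ⟨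
      cdist s a + cdist a b  ∎)
      where open ≤-Reasoning

    gap⇒inside : 2 ≤ cdist a b → ∃[ w ] Inside (cdist s) a b w
    gap⇒inside gap with cdist-surjective s (<-trans (a+1<b gap) (cdist<n s b))
    ... | w , w≡a+1 = w , subst (cdist s a <_) (sym w≡a+1) ≤-refl , subst (_< cdist s b) (sym w≡a+1) (a+1<b gap)

    outside⇒gap : ∀ {w} → Outside (cdist s) a b w → 2 ≤ cdist b a
    outside⇒gap w-out = +-cancelˡ-≤ (cdist s b) 2 _ (begin
      cdist s b + 2          ≡⟨ +-comm (cdist s b) 2 ⟩
      suc (suc (cdist s b))  ≤⟨ beyond w-out ⟩
      n + cdist s a          ≡⟨ cdist-wrap s b a a<b ⟨
      cdist s b + cdist b a  ∎)
      where
      open ≤-Reasoning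
      beyond : ∀ {w} → Outside (cdist s) a b w → suc (suc (cdist s b)) ≤ n + cdist s a
      beyond (inj₁ w<a) = subst (_≤ n + cdist s a) (+-comm (suc (cdist s b)) 1)
                                (+-mono-≤ (cdist<n s b) (<-≤-trans (s≤s z≤n) w<a))
      beyond {w} (inj₂ b<w) = ≤-trans (<-≤-trans (s≤s b<w) (cdist<n s w)) (m≤m+n n _)

    gap⇒outside : 2 ≤ cdist b a → ∃[ w ] Outside (cdist s) a b w
    gap⇒outside gap with suc (cdist s b) <? n
    ... | yes b+1<n with cdist-surjective s b+1<n
    ...   | w , w≡b+1 = w , inj₂ (subst (cdist s b <_) (sym w≡b+1) ≤-refl)
    gap⇒outside gap | no b+1≮n = s , inj₁ (subst (_< cdist s a) (sym (cdist-self s)) 0<a)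
      where
      open ≤-Reasoning
      0<a : 0 < cdist s a
      0<a = +-cancelˡ-≤ (suc (cdist s b)) 1 _ (begin
        suc (cdist s b) + 1          ≡⟨ +-comm (suc (cdist s b)) 1 ⟩
        suc (suc (cdist s b))        ≡⟨ +-comm 2 (cdist s b) ⟩
        cdist s b + 2                ≤⟨ +-monoʳ-≤ (cdist s b) gap ⟩
        cdist s b + cdist b a        ≡⟨ cdist-wrap s b a a<b ⟩
        n + cdist s a                ≤⟨ +-monoˡ-≤ (cdist s a) (≮⇒≥ b+1≮n) ⟩
        suc (cdist s b) + cdist s a  ∎)

walk-snoc : ∀ {n} {E : Graph n} {m a b c} → Walk E m a b → E b c → Walk E (suc m) a c
walk-snoc (here _)   e = step e (here _)
walk-snoc (step e′ w) e = step e′ (walk-snoc w e)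

walk-length-positive : ∀ {n} {E : Graph n} {m a b} → a ≢ b → Walk E m a b → 0 < m
walk-length-positive a≢b (here _)  = contradiction refl a≢b
walk-length-positive a≢b (step _ _) = s≤s z≤n

walk? : ∀ {n} {E : Graph n} → Decidable₂ E → ∀ m a b → Dec (Walk E m a b)
walk? E? zero a b with a ≟ᶠ b
... | yes refl = yes (here a)
... | no a≢b   = no λ { (here _) → a≢b refl }
walk? E? (suc m) a b with any? (λ c → E? a c ×-dec walk? E? m c b)
... | yes (c , e , w) = yes (step e w)
... | no ∄c           = no λ { (step e w) → ∄c (_ , e , w) }

¬¬-decidable : ∀ {n} (E : Graph n) → ¬ ¬ Decidable₂ E
¬¬-decidable E = sequence rawApplicative (λ a → sequence rawApplicative (λ b → ¬¬-excluded-middle))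
  where open RawMonad ¬¬-Monad

least : {P : ℕ → Set} → Decidable P → ∀ {m} → P m → ∃[ j ] P j × (∀ {i} → P i → j ≤ i)
least P? {zero} P0 = zero , P0 , λ _ → z≤n
least P? {suc m} Pm with P? zero
... | yes P0 = zero , P0 , λ _ → z≤n
... | no ¬P0 with least (P? ∘ suc) Pm
...   | j , Pj , minimal = suc j , Pj , λ { {zero} P0 → contradiction P0 ¬P0 ; {suc i} Pi → s≤s (minimal Pi) }

maximise : {A : Set} (xs : List A) → (∀ a → a ∈ xs) → {P : A → Set} → Decidable P → (f : A → ℕ) →
           ∀ {a} → P a → ∃[ b ] P b × (∀ {c} → P c → f c ≤ f b)
maximise xs complete P? f {a} Pa =
  argmax f a candidates , argmax-all f Pa (all-filter P? xs) ,
  λ {c} Pc → lookup (f[xs]≤f[argmax] a candidates) (∈-filter⁺ P? (complete c) Pc)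
  where candidates = filter P? xs

module Chords {n : ℕ} {E : Graph n} (G : MaximalOuterplanar n E) (s : Fin n) where
  open MaximalOuterplanar G

  private
    p : Fin n → ℕ
    p = cdist s

  edges-not-separated : ∀ {a b c d} → E a b → E c d → Inside p a b c → Outside p a b d → ⊥
  edges-not-separated {a} {b} {c} {d} eab ecd c-in d-out = nonCrossing a b c d eab ecd
    (interleaved⇒cross (rotation-interleaved {f = toℕ} {g = p} (rotation-toℕ-cdist s) (separated⇒interleaved p c-in d-out)))

  unseparated-edge : ∀ {a b} → p a < p b → (∀ {c d} → E c d → Inside p a b c → ¬ Outside p a b d) → E a b
  unseparated-edge {a} {b} a<b unseparated = saturated a b (λ a≡b → <-irrefl (cong p a≡b) a<b) λ c d ecd cross →
    [ (λ (c-in , d-out) → unseparated ecd c-in d-out) , (λ (d-in , c-out) → unseparated (symmetric c d ecd) d-in c-out) ]′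
    (interleaved⇒separated p a<b (rotation-interleaved {f = p} {g = toℕ} (rotation-cdist-toℕ s) (cross⇒interleaved cross)))

  position : ∀ {a b} → p a < p b → ∀ w → w ≡ a ⊎ w ≡ b ⊎ Inside p a b w ⊎ Outside p a b w
  position {a} {b} a<b w with <-cmp (p w) (p a)
  ... | tri< w<a _ _ = inj₂ (inj₂ (inj₂ (inj₁ w<a)))
  ... | tri≈ _ w≡a _ = inj₁ (cdist-injective s w≡a)
  ... | tri> _ _ a<w with <-cmp (p w) (p b)
  ...   | tri< w<b _ _ = inj₂ (inj₂ (inj₁ (a<w , w<b)))
  ...   | tri≈ _ w≡b _ = inj₂ (inj₁ (cdist-injective s w≡b))
  ...   | tri> _ _ b<w = inj₂ (inj₂ (inj₂ (inj₂ b<w)))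

  walk-through-chord : ∀ {a b w z m} → E a b → Outside p a b w → Inside p a b z → Walk E m w z →
                       ∃[ c ] (c ≡ a ⊎ c ≡ b) × ∃[ m₁ ] suc m₁ < m × Walk E (suc m₁) w c
  walk-through-chord eab (inj₁ w<a) (a<z , _) (here _) = ⊥-elim (<-asym w<a a<z)
  walk-through-chord eab (inj₂ b<w) (_ , z<b) (here _) = ⊥-elim (<-asym b<w z<b)
  walk-through-chord {a} {b} eab w-out z-in@(a<z , z<b) (step {y = w′} e walk) with position (<-trans a<z z<b) w′
  ... | inj₁ refl =
    a , inj₁ refl , 0 , s≤s (walk-length-positive (λ a≡z → <-irrefl (cong p a≡z) a<z) walk) , step e (here a)
  ... | inj₂ (inj₁ refl) =
    b , inj₂ refl , 0 , s≤s (walk-length-positive (λ b≡z → <-irrefl (cong p (sym b≡z)) z<b) walk) , step e (here b)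
  ... | inj₂ (inj₂ (inj₁ w′-in)) = ⊥-elim (edges-not-separated eab (symmetric _ _ e) w′-in w-out)
  ... | inj₂ (inj₂ (inj₂ w′-out)) with walk-through-chord eab w′-out z-in walk
  ...   | c , c-end , m₁ , m₁<m , walk₁ = c , c-end , suc m₁ , s≤s m₁<m , step e walk₁

  -- c is the neighbour of a between a and b farthest from a: an edge separating c from b
  -- would cross ab or ac, or join a to a farther neighbour.
  triangle : Decidable₂ E → ∀ {a b w} → E a b → Inside p a b w → ∃[ c ] Inside p a b c × E a c × E c b
  triangle E? {a} {b} {w} eab (a<w , w<b) = apex (maximise (allFin n) ∈-allFin neighbour? p (proj₂ next-neighbour))
    where
    Neighbour : Fin n → Set
    Neighbour z = E a z × Inside p a b z

    neighbour? : Decidable Neighbour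
    neighbour? z = E? a z ×-dec ((p a <? p z) ×-dec (p z <? p b))

    a+1<b : suc (p a) < p b
    a+1<b = <-≤-trans (s≤s a<w) w<b

    next-neighbour : ∃[ z ] Neighbour z
    next-neighbour with cdist-surjective s (<-trans a+1<b (cdist<n s b))
    ... | next , next≡a+1 = next ,
      unseparated-edge a<next (λ _ (a<c , c<next) _ → <⇒≱ a<c (s≤s⁻¹ (subst (_ <_) next≡a+1 c<next))) ,
      a<next , subst (_< p b) (sym next≡a+1) a+1<b
      where a<next = subst (p a <_) (sym next≡a+1) ≤-refl

    apex : ∃[ c ] Neighbour c × (∀ {z} → Neighbour z → p z ≤ p c) → ∃[ c ] Inside p a b c × E a c × E c b
    apex (c , (eac , a<c , c<b) , farthest) = c , (a<c , c<b) , eac , unseparated-edge c<b no-separated-edge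
      where
      no-separated-edge : ∀ {e f} → E e f → Inside p c b e → ¬ Outside p c b f
      no-separated-edge eef (c<e , e<b) (inj₂ b<f) = edges-not-separated eab eef (<-trans a<c c<e , e<b) (inj₂ b<f)
      no-separated-edge {e} {f} eef (c<e , e<b) (inj₁ f<c) with <-cmp (p f) (p a)
      ... | tri< f<a _ _ = edges-not-separated eab eef (<-trans a<c c<e , e<b) (inj₁ f<a)
      ... | tri≈ _ f≡a _ =
        <⇒≱ c<e (farthest (symmetric e a (subst (E e) (cdist-injective s f≡a) eef) , <-trans a<c c<e , e<b))
      ... | tri> _ _ a<f = edges-not-separated eac (symmetric e f eef) (a<f , f<c) (inj₂ c<e)

module _ {n : ℕ} {E : Graph n} (G : MaximalOuterplanar n E) {k : ℕ} {u v : Fin (suc k) → Fin n}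
         (M : ParallelMatching E (suc k) u v) where
  open ParallelMatching M
  open Chords G start

  private
    p : Fin n → ℕ
    p = cdist start

  outside-all-chords : ∀ {x} → Outside p (u zero) (v zero) x → ∀ i → Outside p (u i) (v i) x
  outside-all-chords x-out       zero    = x-out
  outside-all-chords (inj₁ x<u₀) (suc i) = inj₁ (<-trans x<u₀ (uOrder zero (suc i) (s≤s z≤n)))
  outside-all-chords (inj₂ v₀<x) (suc i) = inj₂ (<-trans (vOrder zero (suc i) (s≤s z≤n)) v₀<x)

  walk-into-chord : ∀ {x} → Outside p (u zero) (v zero) x →
                    ∀ i {m z} → Inside p (u i) (v i) z → Walk E m x z → 2 + toℕ i ≤ m
  walk-into-chord {x} x-out = <-weakInduction Far base next
    where
    Far : Fin (suc k) → Set
    Far i = ∀ {m z} → Inside p (u i) (v i) z → Walk E m x z → 2 + toℕ i ≤ m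

    base : Far zero
    base z-in walk with walk-through-chord (edges zero) x-out z-in walk
    ... | _ , _ , _ , m₁<m , _ = ≤-trans (s≤s (s≤s z≤n)) m₁<m

    next : ∀ i → Far (inject₁ i) → Far (suc i)
    next i far z-in walk with walk-through-chord (edges (suc i)) (outside-all-chords x-out (suc i)) z-in walk
    ... | c , c-end , m₁ , m₁<m , walk₁ =
      ≤-trans (s≤s (subst (λ j → 2 + j ≤ suc m₁) (toℕ-inject₁ i) (far (nested c-end) walk₁))) m₁<m
      where
      i<i+1 : inject₁ i ≺ suc i
      i<i+1 = subst (_< suc (toℕ i)) (sym (toℕ-inject₁ i)) ≤-refl
      nested : ∀ {c} → c ≡ u (suc i) ⊎ c ≡ v (suc i) → Inside p (u (inject₁ i)) (v (inject₁ i)) c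
      nested (inj₁ refl) = uOrder _ _ i<i+1 , uvOrder _ _
      nested (inj₂ refl) = uvOrder _ _ , vOrder _ _ i<i+1

  far-pair : ∃[ x ] ∃[ y ] ∀ {m} → Walk E m x y → 2 + k ≤ m
  far-pair with gap⇒outside start (uvOrder zero zero) (gapFirst zero refl)
              | gap⇒inside start (uvOrder _ _) (gapLast (fromℕ k) (cong suc (toℕ-fromℕ k)))
  ... | x , x-out | y , y-in =
    x , y , λ walk → subst (λ j → 2 + j ≤ _) (toℕ-fromℕ k) (walk-into-chord x-out (fromℕ k) y-in walk)

matching≤diameter∸1 : ∀ {n} {E : Graph n} → MaximalOuterplanar n E → ∀ {D} → HasDiameter E D →
                      ∀ {k u v} → ParallelMatching E k u v → k ≤ D ∸ 1
matching≤diameter∸1 G _ {k = zero} _ = z≤n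
matching≤diameter∸1 G (bounded , _) {k = suc k} M with far-pair G M
... | x , y , far with bounded x y
...   | m , m≤D , walk = ∸-monoˡ-≤ 1 (≤-trans (far walk) m≤D)

module Levels {n : ℕ} {E : Graph n} (G : MaximalOuterplanar n E) (E? : Decidable₂ E)
              (x y : Fin n) (reach : ∀ w → ∃[ m ] Walk E m x w) where
  open MaximalOuterplanar G
  open Chords G x

  p : Fin n → ℕ
  p = cdist x

  shortest : ∀ w → ∃[ d ] Walk E d x w × (∀ {m} → Walk E m x w → d ≤ m)
  shortest w = least (λ m → walk? E? m x w) (proj₂ (reach w))

  dist : Fin n → ℕ
  dist w = proj₁ (shortest w)

  dist-walk : ∀ w → Walk E (dist w) x w
  dist-walk w = proj₁ (proj₂ (shortest w))

  dist-minimal : ∀ {m w} → Walk E m x w → dist w ≤ m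
  dist-minimal {w = w} = proj₂ (proj₂ (shortest w))

  dist-edge : ∀ {w z} → E w z → dist z ≤ suc (dist w)
  dist-edge {w} e = dist-minimal (walk-snoc (dist-walk w) e)

  dist-base : dist x ≡ 0
  dist-base = n≤0⇒n≡0 (dist-minimal (here x))

  after-base : ∀ {w} → 0 < dist w → p x < p w
  after-base {w} 0<dw = subst (_< p w) (sym (cdist-self x)) (n≢0⇒n>0 pw≢0)
    where
    pw≢0 : p w ≢ 0
    pw≢0 pw≡0 with cdist-injective x (trans pw≡0 (sym (cdist-self x)))
    ... | refl = <-irrefl (sym dist-base) 0<dw

  endpoint-closer : ∀ {a b z} → E a b → Outside p a b x → Inside p a b z →
                    ∃[ c ] (c ≡ a ⊎ c ≡ b) × dist c < dist z
  endpoint-closer eab x-out z-in with walk-through-chord eab x-out z-in (dist-walk _)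
  ... | c , c-end , _ , m₁<m , walk₁ = c , c-end , ≤-<-trans (dist-minimal walk₁) m₁<m

  Separating : Fin n → Fin n → Set
  Separating a b = E a b × p a < p y × p y < p b

  record LevelChord (i : ℕ) : Set where
    field
      left right : Fin n
      edge       : E left right
      left<y     : p left < p y
      y<right    : p y < p right
      dist-left  : dist left ≡ i
      dist-right : dist right ≡ i

  x-outside-level-chord : ∀ {i} → 0 < i → (C : LevelChord i) → Outside p (LevelChord.left C) (LevelChord.right C) x
  x-outside-level-chord 0<i C = inj₁ (after-base (subst (0 <_) (sym (LevelChord.dist-left C)) 0<i))

  level-chords-nested : ∀ {i j} (C : LevelChord i) (C′ : LevelChord j) → i < j →
                        p (LevelChord.left C) < p (LevelChord.left C′) × p (LevelChord.right C′) < p (LevelChord.right C)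
  level-chords-nested {i} {j} C C′ i<j = left-nested , right-nested
    where
    module C = LevelChord C
    module C′ = LevelChord C′

    beyond-level : ∀ {z} → Inside p C′.left C′.right z → j < dist z
    beyond-level z-in with endpoint-closer C′.edge (x-outside-level-chord (≤-trans (s≤s z≤n) i<j) C′) z-in
    ... | _ , inj₁ refl , c<z = subst (_< _) C′.dist-left c<z
    ... | _ , inj₂ refl , c<z = subst (_< _) C′.dist-right c<z

    distinct-levels : ∀ {a a′} → dist a ≡ i → dist a′ ≡ j → p a ≢ p a′
    distinct-levels da da′ pa≡pa′ = <-irrefl (trans (sym da) (trans (cong dist (cdist-injective x pa≡pa′)) da′)) i<j

    left-nested : p C.left < p C′.left
    left-nested with <-cmp (p C.left) (p C′.left)
    ... | tri< a<a′ _ _ = a<a′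
    ... | tri≈ _ a≡a′ _ = ⊥-elim (distinct-levels C.dist-left C′.dist-left a≡a′)
    ... | tri> _ _ a′<a =
      ⊥-elim (<-asym i<j (subst (j <_) C.dist-left (beyond-level (a′<a , <-trans C.left<y C′.y<right))))

    right-nested : p C′.right < p C.right
    right-nested with <-cmp (p C′.right) (p C.right)
    ... | tri< b′<b _ _ = b′<b
    ... | tri≈ _ b′≡b _ = ⊥-elim (distinct-levels C.dist-right C′.dist-right (sym b′≡b))
    ... | tri> _ _ b<b′ =
      ⊥-elim (<-asym i<j (subst (j <_) C.dist-right (beyond-level (<-trans C′.left<y C.y<right , b<b′))))

  outer-chord : 2 ≤ dist y → ∃[ z ] Separating x z × dist z ≤ 1
  outer-chord 2≤dy = z , (exz , x<y , y<z) , subst (λ d → dist z ≤ suc d) dist-base (dist-edge exz)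
    where
    x<y : p x < p y
    x<y = after-base (≤-trans (s≤s z≤n) 2≤dy)
    last = maximise (allFin n) ∈-allFin {P = λ _ → ⊤} (λ _ → yes tt) p {x} tt
    z = proj₁ last
    below-z : ∀ w → p w ≤ p z
    below-z w = proj₂ (proj₂ last) tt
    exz : E x z
    exz = unseparated-edge (<-≤-trans x<y (below-z y)) nothing-outside
      where
      nothing-outside : ∀ {c d} → E c d → Inside p x z c → ¬ Outside p x z d
      nothing-outside {d = d} _ _ (inj₁ d<x) = <⇒≱ d<x (subst (_≤ p d) (sym (cdist-self x)) z≤n)
      nothing-outside {d = d} _ _ (inj₂ z<d) = <⇒≱ z<d (below-z d)
    y<z : p y < p z
    y<z = ≤∧≢⇒< (below-z y) λ y≡z → <⇒≱ 2≤dy (subst (λ d → dist y ≤ suc d) dist-base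
                                               (dist-edge (subst (E x) (cdist-injective x (sym y≡z)) exz)))

  Within : ℕ → Fin n × Fin n → Set
  Within i (a , b) = Separating a b × dist a ≤ i × dist b ≤ i

  -- Grows as a chord separating x from y moves towards y (p b < n, so the subtraction is exact).
  depth : Fin n × Fin n → ℕ
  depth (a , b) = p a + (n ∸ p b)

  Innermost : ℕ → Fin n × Fin n → Set
  Innermost i ab = Within i ab × (∀ {ab′} → Within i ab′ → depth ab′ ≤ depth ab)

  innermost-chord : ∀ i → 1 ≤ i → i < dist y → ∃[ ab ] Innermost i ab
  innermost-chord i 1≤i i<dy with outer-chord (≤-trans (s≤s 1≤i) i<dy)
  ... | z , xz-separating , z≤1 =
    maximise (cartesianProduct (allFin n) (allFin n)) (λ (a , b) → ∈-cartesianProduct⁺ (∈-allFin a) (∈-allFin b))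
             within? depth (xz-separating , subst (_≤ i) (sym dist-base) z≤n , ≤-trans z≤1 1≤i)
    where
    within? : Decidable (Within i)
    within? (a , b) = (E? a b ×-dec (p a <? p y ×-dec p y <? p b)) ×-dec (dist a ≤? i ×-dec dist b ≤? i)

  -- Either c = y, or c is within level i and then cb or ac is a deeper chord within level i.
  apex-beyond-level : ∀ {i a b c} → i < dist y → Innermost i (a , b) → Inside p a b c → E a c → E c b → i < dist c
  apex-beyond-level {i} {a} {b} {c} i<dy (((_ , a<y , y<b) , a≤i , b≤i) , deepest) (a<c , c<b) eac ecb
    with <-cmp (p c) (p y)
  ... | tri≈ _ c≡y _ = subst (λ w → i < dist w) (sym (cdist-injective x c≡y)) i<dy
  ... | tri< c<y _ _ = ≰⇒> λ c≤i → <⇒≱ (+-monoˡ-< (n ∸ p b) a<c) (deepest ((ecb , c<y , y<b) , c≤i , b≤i))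
  ... | tri> _ _ y<c = ≰⇒> λ c≤i →
    <⇒≱ (+-monoʳ-< (p a) (∸-monoʳ-< c<b (<⇒≤ (cdist<n x b)))) (deepest ((eac , a<y , y<c) , a≤i , c≤i))

  level-chord : ∀ i → 1 ≤ i → i < dist y → LevelChord i
  level-chord i 1≤i i<dy = from-innermost (innermost-chord i 1≤i i<dy)
    where
    from-innermost : ∃[ ab ] Innermost i ab → LevelChord i
    from-innermost ((a , b) , innermost@(((eab , a<y , y<b) , a≤i , b≤i) , _)) with triangle E? eab (a<y , y<b)
    ... | c , c-in , eac , ecb = record
      { left = a ; right = b ; edge = eab ; left<y = a<y ; y<right = y<b
      ; dist-left = ≤-antisym a≤i (s≤s⁻¹ (≤-trans i<c (dist-edge eac)))
      ; dist-right = ≤-antisym b≤i (s≤s⁻¹ (≤-trans i<c (dist-edge (symmetric c b ecb))))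
      }
      where i<c = apex-beyond-level i<dy innermost c-in eac ecb

  level-matching : HasParallelMatching E (dist y ∸ 1)
  level-matching = left , right , record
    { edges    = edge
    ; start    = x
    ; uOrder   = λ i j i<j → proj₁ (level-chords-nested (chord i) (chord j) (s≤s i<j))
    ; uvOrder  = λ i j → <-trans (left<y i) (y<right j)
    ; vOrder   = λ i j i<j → proj₂ (level-chords-nested (chord i) (chord j) (s≤s i<j))
    ; gapFirst = λ j _ → outside⇒gap x (<-trans (left<y j) (y<right j)) (x-outside-level-chord (s≤s z≤n) (chord j))
    ; gapLast  = λ j _ → inside⇒gap x (<-trans (left<y j) (y<right j)) (left<y j , y<right j)
    }
    where
    level< : ∀ {d} → (j : Fin (d ∸ 1)) → suc (toℕ j) < d
    level< {suc d} j = s≤s (toℕ<n j)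

    chord : (j : Fin (dist y ∸ 1)) → LevelChord (suc (toℕ j))
    chord j = level-chord (suc (toℕ j)) (s≤s z≤n) (level< j)

    open module Chord j = LevelChord (chord j)

diameter∸1≤maximum-matching : ∀ {n} {E : Graph n} → MaximalOuterplanar n E → Decidable₂ E →
                              ∀ {D} → HasDiameter E D → ∀ {k u v} → MaximumParallelMatching E k u v → D ∸ 1 ≤ k
diameter∸1≤maximum-matching G E? (bounded , x , y , far) M =
  ≤-trans (∸-monoˡ-≤ 1 (far _ (dist-walk y))) (MaximumParallelMatching.maximum M _ level-matching)
  where open Levels G E? x y (λ w → proj₁ (bounded x w) , proj₂ (proj₂ (bounded x w)))

corollary4 : (n : ℕ) (E : Graph n) → MaximalOuterplanar n E →
    (D : ℕ) → HasDiameter E D →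
    (k : ℕ) (u v : Fin k → Fin n) → MaximumParallelMatching E k u v →
    k ≡ D ∸ 1
corollary4 n E G D diameter k u v M = ≤-antisym
  (matching≤diameter∸1 G diameter (MaximumParallelMatching.isParallel M))
  -- Adjacency is not assumed decidable; it is so up to double negation, which suffices for a goal in ℕ.
  (decidable-stable (D ∸ 1 ≤? k) (¬¬-map (λ E? → diameter∸1≤maximum-matching G E? diameter M) (¬¬-decidable E)))
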